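{- Let $G=(V,E)$ be a connected graph with $|V|=n$ and let $k\ge1$ be an integer. Then there is a family of at most $k$ connected induced subgraphs of $G$, each with at most $2\lfloor \frac{n}{k+1}\rfloor+1$ vertices, whose vertex sets together cover $V$. -}

module Defs where

open import Level using (Level; _⊔_) renaming (suc to lsuc; zero to lzero)
open import Data.Nat using (ℕ; suc)
open import Data.Fin using (Fin)
open import Data.Fin.Subset using (Subset; _∈_)
open import Data.List using (List; _∷_; [])
open import Data.Product using (∃; _×_)
open import Relation.Nullary using (¬_)
open import Relation.Binary.PropositionalEquality using (_≡_)

record Graph (n : ℕ) : Set₁ where
  field
    Adj     : Fin n → Fin n → Set
    sym     : ∀ {u v} → Adj u v → Adj v u
    irrefl  : ∀ {v} → ¬ Adj v v

open Graph public

data WalkIn {n : ℕ} (G : Graph n) (S : Subset n) : Fin n → Fin n → Set where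
  [] : ∀ {v} → v ∈ S → WalkIn G S v v
  step : ∀ {u w v} → u ∈ S → Adj G u w → WalkIn G S w v → WalkIn G S u v

data Walk {n : ℕ} (G : Graph n) : Fin n → Fin n → Set where
  [] : ∀ {v} → Walk G v v
  step : ∀ {u w v} → Adj G u w → Walk G w v → Walk G u v

Connected : {n : ℕ} → Graph n → Set
Connected G = ∀ u v → Walk G u v

InducedConnected : {n : ℕ} → Graph n → Subset n → Set
InducedConnected G S = ∃ (λ v → v ∈ S) × (∀ u v → u ∈ S → v ∈ S → WalkIn G S u v)

-- Take a spanning tree T of G (so |T| = n) and put m = ⌊n/(k+1)⌋.
-- Repeatedly cut from T a connected piece P with m+1 ≤ |P| ≤ 2m+1, keeping
-- the remainder a tree, until the remainder itself has at most 2m+1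
-- vertices.  Every cut removes at least m+1 vertices (the piece may share
-- one vertex with the remainder), so when there are ℓ ≥ 2 pieces we get
-- ℓ(m+1) ≤ n < (k+1)(m+1), i.e. ℓ ≤ k.  Each piece is a subtree of G,
-- hence its vertex set induces a connected subgraph.

module Submission where

open import Defs
open import Function using (_∘_)
open import Data.Nat using (ℕ; zero; suc; _+_; _*_; _≤_; _<_; _/_; _%_; z≤n; s≤s; s≤s⁻¹; _≤?_)
open import Data.Nat.Properties
open import Data.Nat.DivMod using (m≡m%n+[m/n]*n; m%n<n)
open import Algebra.Properties.CommutativeSemigroup +-commutativeSemigroup using (x∙yz≈y∙xz)
open import Data.Fin using (Fin) renaming (zero to fzero; suc to fsuc)
open import Data.Fin.Properties using (injective⇒≤; all?; ¬∀⟶∃¬)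
open import Data.Vec using ([]; _∷_)
open import Data.Fin.Subset using (Subset; _∈_; ∣_∣; ⁅_⁆; _∪_; inside; outside) renaming (⊥ to ∅)
open import Data.Fin.Subset.Properties using (∉⊥; ∣⊥∣≡0; ∣⁅x⁆∣≡1; x∈⁅x⁆; x∈⁅y⁆⇒x≡y; x∈p∪q⁺; x∈p∪q⁻)
open import Data.List using (List; []; _∷_; _++_; length; map; lookup)
open import Data.List.Properties using (length-++; length-map)
open import Data.List.Relation.Unary.All as All using (All; []; _∷_)
import Data.List.Relation.Unary.All.Properties as All
open import Data.List.Relation.Unary.Any as Any using (Any; here; there)
import Data.List.Relation.Unary.Any.Properties as Any
open import Data.List.Membership.Propositional using () renaming (_∈_ to _∈ₗ_)
open import Data.List.Membership.Propositional.Properties using (∈-++⁺ˡ; ∈-++⁺ʳ; ∈-++⁻; ∈-lookup)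
open import Data.List.Relation.Unary.Unique.Propositional using (Unique)
open import Data.List.Relation.Unary.AllPairs using ([]; _∷_)
open import Data.List.Relation.Binary.Permutation.Propositional using (_↭_; refl; prep; swap; trans; ↭-sym; ↭⇒↭ₛ)
open import Data.List.Relation.Binary.Permutation.Propositional.Properties using (↭-length; ++⁺ˡ; ++⁺ʳ; shift)
import Data.List.Relation.Binary.Permutation.Setoid.Properties as Permutationₛ
open import Data.Product using (∃; Σ; _×_; _,_; proj₁; proj₂)
open import Data.Sum using (_⊎_; inj₁; inj₂; [_,_]) renaming (map₂ to map⊎₂)
open import Data.Unit using (⊤; tt)
open import Data.Empty using (⊥-elim)
open import Function.Definitions using (Injective)
open import Relation.Nullary using (¬_; yes; no; contradiction)
open import Relation.Binary.PropositionalEquality as ≡ using (_≡_; refl; cong)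

module _ {n : ℕ} where

  toSubset : List (Fin n) → Subset n
  toSubset []       = ∅
  toSubset (x ∷ xs) = ⁅ x ⁆ ∪ toSubset xs

  ∈-toSubset⁺ : ∀ {x xs} → x ∈ₗ xs → x ∈ toSubset xs
  ∈-toSubset⁺ {xs = y ∷ _} (here refl) = x∈p∪q⁺ (inj₁ (x∈⁅x⁆ y))
  ∈-toSubset⁺              (there p)   = x∈p∪q⁺ (inj₂ (∈-toSubset⁺ p))

  ∈-toSubset⁻ : ∀ {x} xs → x ∈ toSubset xs → x ∈ₗ xs
  ∈-toSubset⁻ []       p = ⊥-elim (∉⊥ p)
  ∈-toSubset⁻ (y ∷ ys) p =
    [ here ∘ x∈⁅y⁆⇒x≡y y , there ∘ ∈-toSubset⁻ ys ] (x∈p∪q⁻ ⁅ y ⁆ (toSubset ys) p)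

∣p∪q∣≤∣p∣+∣q∣ : ∀ {n} (p q : Subset n) → ∣ p ∪ q ∣ ≤ ∣ p ∣ + ∣ q ∣
∣p∪q∣≤∣p∣+∣q∣ []            []            = z≤n
∣p∪q∣≤∣p∣+∣q∣ (inside ∷ p)  (inside ∷ q)  = s≤s (≤-trans (∣p∪q∣≤∣p∣+∣q∣ p q) (+-monoʳ-≤ ∣ p ∣ (n≤1+n ∣ q ∣)))
∣p∪q∣≤∣p∣+∣q∣ (inside ∷ p)  (outside ∷ q) = s≤s (∣p∪q∣≤∣p∣+∣q∣ p q)
∣p∪q∣≤∣p∣+∣q∣ (outside ∷ p) (inside ∷ q)  = ≤-trans (s≤s (∣p∪q∣≤∣p∣+∣q∣ p q)) (≤-reflexive (≡.sym (+-suc ∣ p ∣ ∣ q ∣)))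
∣p∪q∣≤∣p∣+∣q∣ (outside ∷ p) (outside ∷ q) = ∣p∪q∣≤∣p∣+∣q∣ p q

∣toSubset∣≤length : ∀ {n} (xs : List (Fin n)) → ∣ toSubset xs ∣ ≤ length xs
∣toSubset∣≤length {n} []       = ≤-reflexive (∣⊥∣≡0 n)
∣toSubset∣≤length     (x ∷ xs) = begin
  ∣ ⁅ x ⁆ ∪ toSubset xs ∣       ≤⟨ ∣p∪q∣≤∣p∣+∣q∣ ⁅ x ⁆ (toSubset xs) ⟩
  ∣ ⁅ x ⁆ ∣ + ∣ toSubset xs ∣   ≡⟨ cong (_+ ∣ toSubset xs ∣) (∣⁅x⁆∣≡1 x) ⟩
  suc ∣ toSubset xs ∣           ≤⟨ s≤s (∣toSubset∣≤length xs) ⟩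
  suc (length xs)               ∎
  where open ≤-Reasoning

module _ {n : ℕ} where

  lookup-injective : ∀ {xs : List (Fin n)} → Unique xs → Injective _≡_ _≡_ (lookup xs)
  lookup-injective (_    ∷ _) {fzero}  {fzero}  _ = refl
  lookup-injective (x∉xs ∷ _) {fzero}  {fsuc j} e = contradiction e (All.lookup x∉xs (∈-lookup j))
  lookup-injective (x∉xs ∷ _) {fsuc i} {fzero}  e = contradiction (≡.sym e) (All.lookup x∉xs (∈-lookup i))
  lookup-injective (_    ∷ u) {fsuc i} {fsuc j} e = cong fsuc (lookup-injective u e)

  unique-length≤ : ∀ {xs : List (Fin n)} → Unique xs → length xs ≤ n
  unique-length≤ u = injective⇒≤ (lookup-injective u)

  unique-resp-↭ : ∀ {xs ys : List (Fin n)} → xs ↭ ys → Unique xs → Unique ys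
  unique-resp-↭ p = Permutationₛ.Unique-resp-↭ (≡.setoid (Fin n)) (↭⇒↭ₛ p)

module _ {n : ℕ} {G : Graph n} where

  sourceIn : ∀ {S a b} → WalkIn G S a b → a ∈ S
  sourceIn ([] aS)       = aS
  sourceIn (step aS _ _) = aS

  _++ʷ_ : ∀ {S a b c} → WalkIn G S a b → WalkIn G S b c → WalkIn G S a c
  [] _           ++ʷ q = q
  step aS adj p  ++ʷ q = step aS adj (p ++ʷ q)

  reverseʷ : ∀ {S a b} → WalkIn G S a b → WalkIn G S b a
  reverseʷ ([] aS)         = [] aS
  reverseʷ (step aS adj p) = reverseʷ p ++ʷ step (sourceIn p) (sym G adj) ([] aS)

≤m⇒≤2m : ∀ {a} m → a ≤ m → a ≤ 2 * m
≤m⇒≤2m m a≤m = ≤-trans a≤m (m≤m+n m (m + 0))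

+-≤2m : ∀ {a b} m → a ≤ m → b ≤ m → a + b ≤ 2 * m
+-≤2m m a≤m b≤m = +-mono-≤ a≤m (≤-trans b≤m (m≤m+n m 0))

≤2m⇒<2m+1 : ∀ {a} m → a ≤ 2 * m → suc a ≤ 2 * m + 1
≤2m⇒<2m+1 m a≤2m = ≤-trans (s≤s a≤2m) (≤-reflexive (+-comm 1 (2 * m)))

-- Rose trees labelled by vertices; a vertex may a priori occur several times.
data Tree (n : ℕ) : Set where
  node : Fin n → List (Tree n) → Tree n

module _ {n : ℕ} where

  mutual
    labs : Tree n → List (Fin n)
    labs (node v cs) = v ∷ labsL cs

    labsL : List (Tree n) → List (Fin n)
    labsL []       = []
    labsL (c ∷ cs) = labs c ++ labsL cs

  mutual
    size : Tree n → ℕ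
    size (node v cs) = suc (sizes cs)

    sizes : List (Tree n) → ℕ
    sizes []       = 0
    sizes (c ∷ cs) = size c + sizes cs

  mutual
    size≡length : ∀ t → size t ≡ length (labs t)
    size≡length (node v cs) = cong suc (sizes≡length cs)

    sizes≡length : ∀ cs → sizes cs ≡ length (labsL cs)
    sizes≡length []       = refl
    sizes≡length (c ∷ cs) = ≡.trans (≡.cong₂ _+_ (size≡length c) (sizes≡length cs)) (≡.sym (length-++ (labs c)))

  ∣labs∣≤size : ∀ t → ∣ toSubset (labs t) ∣ ≤ size t
  ∣labs∣≤size t = ≤-trans (∣toSubset∣≤length (labs t)) (≤-reflexive (≡.sym (size≡length t)))

module Trees {n : ℕ} (G : Graph n) where

  ValidL : Fin n → List (Tree n) → Set
  ValidL v []                = ⊤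
  ValidL v (node w ds ∷ cs)  = Adj G v w × ValidL w ds × ValidL v cs

  ValidT : Tree n → Set
  ValidT (node v cs) = ValidL v cs

  mutual
    reachN : ∀ {S x} v cs → ValidL v cs → All (_∈ S) (v ∷ labsL cs) →
             x ∈ₗ (v ∷ labsL cs) → WalkIn G S v x
    reachN v cs _   (vS ∷ _)   (here refl) = [] vS
    reachN v cs val (vS ∷ csS) (there p)   = reachL v cs val vS csS p

    reachL : ∀ {S x} v cs → ValidL v cs → v ∈ S → All (_∈ S) (labsL cs) →
             x ∈ₗ labsL cs → WalkIn G S v x
    reachL v (node w ds ∷ cs) (vw , wds , vcs) vS csS p
      with All.++⁻ (w ∷ labsL ds) csS | ∈-++⁻ (w ∷ labsL ds) p
    ... | wS , _   | inj₁ q = step vS vw (reachN w ds wds wS q)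
    ... | _  , cS  | inj₂ q = reachL v cs vcs vS cS q

  -- The labels of a tree of G induce a connected subgraph: any two labels
  -- are joined through the root.
  tree-connected : ∀ t → ValidT t → InducedConnected G (toSubset (labs t))
  tree-connected (node v cs) val =
    (v , ∈-toSubset⁺ {xs = L} (here refl)) ,
    λ x y xS yS → reverseʷ (reach (∈-toSubset⁻ L xS)) ++ʷ reach (∈-toSubset⁻ L yS)
    where
    L : List (Fin n)
    L = v ∷ labsL cs
    reach : ∀ {x} → x ∈ₗ L → WalkIn G (toSubset L) v x
    reach = reachN v cs val (All.tabulate ∈-toSubset⁺)

  record Peel (m : ℕ) (v : Fin n) (cs : List (Tree n)) : Set where
    constructor peel
    field
      piece      : Tree n
      rest       : List (Tree n)
      pieceValid : ValidT piece
      restValid  : ValidL v rest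
      pieceSmall : size piece ≤ 2 * m + 1
      shrinks    : suc m + sizes rest ≤ sizes cs
      splits     : ∀ {x} → x ∈ₗ labsL cs → x ∈ₗ labs piece ⊎ x ∈ₗ labsL rest

  open Peel

  -- A forest with between m+1 and 2m nodes is peeled off whole, together
  -- with the node v it hangs from (which stays in the remainder too).
  peelWhole : ∀ {m v cs} → ValidL v cs → m < sizes cs → sizes cs ≤ 2 * m → Peel m v cs
  peelWhole {m} {v} {cs} val big small =
    peel (node v cs) [] val tt (≤2m⇒<2m+1 m small) (≤-trans (≤-reflexive (+-identityʳ (suc m))) big) (inj₁ ∘ there)

  peelFirst : ∀ {m v w ds cs} → ValidL w ds → ValidL v cs → m ≤ sizes ds → sizes ds ≤ 2 * m →
              Peel m v (node w ds ∷ cs)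
  peelFirst {m} {w = w} {ds} {cs} wds vcs big small =
    peel (node w ds) cs wds vcs (≤2m⇒<2m+1 m small)
         (+-monoˡ-≤ (sizes cs) (s≤s big)) (∈-++⁻ (w ∷ labsL ds))

  peelBelow : ∀ {m v w ds cs} → Adj G v w → ValidL v cs → Peel m w ds → Peel m v (node w ds ∷ cs)
  peelBelow {m} {w = w} {ds} {cs} vw vcs P =
    peel (piece P) (node w (rest P) ∷ cs) (pieceValid P) (vw , restValid P , vcs) (pieceSmall P)
         shrinks′ splits′
    where
    shrinks′ : suc m + (suc (sizes (rest P)) + sizes cs) ≤ suc (sizes ds) + sizes cs
    shrinks′ = begin
      suc m + (suc (sizes (rest P)) + sizes cs)  ≡⟨ +-suc (suc m) (sizes (rest P) + sizes cs) ⟩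
      suc (suc m + (sizes (rest P) + sizes cs))  ≡⟨ cong suc (≡.sym (+-assoc (suc m) (sizes (rest P)) (sizes cs))) ⟩
      suc (suc m + sizes (rest P)) + sizes cs    ≤⟨ +-monoˡ-≤ (sizes cs) (s≤s (shrinks P)) ⟩
      suc (sizes ds) + sizes cs                  ∎
      where open ≤-Reasoning
    splits′ : ∀ {x} → x ∈ₗ labsL (node w ds ∷ cs) → x ∈ₗ labs (piece P) ⊎ x ∈ₗ labsL (node w (rest P) ∷ cs)
    splits′ p with ∈-++⁻ (w ∷ labsL ds) p
    ... | inj₁ (here e)  = inj₂ (here e)
    ... | inj₁ (there q) = map⊎₂ (∈-++⁺ˡ ∘ there) (splits P q)
    ... | inj₂ q         = inj₂ (∈-++⁺ʳ (w ∷ labsL (rest P)) q)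

  peelBeside : ∀ {m v w ds cs} → Adj G v w → ValidL w ds → Peel m v cs → Peel m v (node w ds ∷ cs)
  peelBeside {m} {w = w} {ds} {cs} vw wds P =
    peel (piece P) (node w ds ∷ rest P) (pieceValid P) (vw , wds , restValid P) (pieceSmall P)
         shrinks′ splits′
    where
    shrinks′ : suc m + (size (node w ds) + sizes (rest P)) ≤ size (node w ds) + sizes cs
    shrinks′ = ≤-trans (≤-reflexive (x∙yz≈y∙xz (suc m) (size (node w ds)) (sizes (rest P))))
                       (+-monoʳ-≤ (size (node w ds)) (shrinks P))
    splits′ : ∀ {x} → x ∈ₗ labsL (node w ds ∷ cs) → x ∈ₗ labs (piece P) ⊎ x ∈ₗ labsL (node w ds ∷ rest P)
    splits′ p with ∈-++⁻ (w ∷ labsL ds) p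
    ... | inj₁ q = inj₂ (∈-++⁺ˡ q)
    ... | inj₂ q = map⊎₂ (∈-++⁺ʳ (w ∷ labsL ds)) (splits P q)

  -- Search the first subtree; if it is small, either it is itself a
  -- piece, or search the remaining subtrees; if those are small too, either
  -- the whole forest is small or it is a piece.
  search : ∀ m v cs → ValidL v cs → sizes cs ≤ m ⊎ Peel m v cs
  search m v []               _                = inj₁ z≤n
  search m v (node w ds ∷ cs) (vw , wds , vcs) with search m w ds wds
  ... | inj₂ P = inj₂ (peelBelow vw vcs P)
  ... | inj₁ ds≤m with m ≤? sizes ds
  ...   | yes m≤ds = inj₂ (peelFirst wds vcs m≤ds (≤m⇒≤2m m ds≤m))
  ...   | no  m≰ds with search m v cs vcs
  ...     | inj₂ P = inj₂ (peelBeside vw wds P)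
  ...     | inj₁ cs≤m with sizes (node w ds ∷ cs) ≤? m
  ...       | yes small = inj₁ small
  ...       | no  big   = inj₂ (peelWhole (vw , wds , vcs) (≰⇒> big) (+-≤2m m (≰⇒> m≰ds) cs≤m))

  record Cover (m : ℕ) (t : Tree n) : Set where
    field
      pieces   : List (Tree n)
      piecesOK : All (λ P → ValidT P × size P ≤ 2 * m + 1) pieces
      covers   : ∀ {x} → x ∈ₗ labs t → Any (λ P → x ∈ₗ labs P) pieces
      few      : length pieces ≤ 1 ⊎ length pieces * suc m ≤ size t

  extendCover : ∀ {m v cs} → 2 * m + 1 < size (node v cs) → (P : Peel m v cs) →
                Cover m (node v (rest P)) → Cover m (node v cs)
  extendCover {m} {v} {cs} big P C = record
    { pieces   = piece P ∷ pieces
    ; piecesOK = (pieceValid P , pieceSmall P) ∷ piecesOK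
    ; covers   = covers′
    ; few      = inj₂ few′
    }
    where
    open Cover C
    covers′ : ∀ {x} → x ∈ₗ labs (node v cs) → Any (λ Q → x ∈ₗ labs Q) (piece P ∷ pieces)
    covers′ (here e)  = there (covers (here e))
    covers′ (there q) with splits P q
    ... | inj₁ inPiece = here inPiece
    ... | inj₂ inRest  = there (covers (there inRest))
    few′ : suc (length pieces) * suc m ≤ suc (sizes cs)
    few′ with Cover.few C
    ... | inj₁ ≤1 = begin
      suc (length pieces) * suc m  ≤⟨ *-monoˡ-≤ (suc m) (s≤s ≤1) ⟩
      2 * suc m                    ≡⟨ *-suc 2 m ⟩
      suc (1 + 2 * m)              ≡⟨ cong suc (+-comm 1 (2 * m)) ⟩
      suc (2 * m + 1)              ≤⟨ big ⟩
      suc (sizes cs)               ∎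
      where open ≤-Reasoning
    ... | inj₂ ≤size = begin
      suc m + length pieces * suc m  ≤⟨ +-monoʳ-≤ (suc m) ≤size ⟩
      suc m + suc (sizes (rest P))   ≡⟨ +-suc (suc m) (sizes (rest P)) ⟩
      suc (suc m + sizes (rest P))   ≤⟨ s≤s (shrinks P) ⟩
      suc (sizes cs)                 ∎
      where open ≤-Reasoning

  coverWithin : ∀ m f t → ValidT t → size t ≤ f → Cover m t
  coverWithin m (suc f) (node v cs) val size≤f with size (node v cs) ≤? 2 * m + 1
  ... | yes small = record
    { pieces = node v cs ∷ [] ; piecesOK = (val , small) ∷ [] ; covers = here ; few = inj₁ ≤-refl }
  ... | no big with search m v cs val
  ...   | inj₁ cs≤m = contradiction (≤2m⇒<2m+1 m (≤m⇒≤2m m cs≤m)) big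
  ...   | inj₂ P    = extendCover (≰⇒> big) P
                        (coverWithin m f (node v (rest P)) (restValid P)
                          (≤-trans (s≤s (m≤n+m (sizes (rest P)) m)) (≤-trans (shrinks P) (s≤s⁻¹ size≤f))))

  cover : ∀ m t → ValidT t → Cover m t
  cover m t val = coverWithin m (size t) t val ≤-refl

  open import Data.List.Membership.DecPropositional (Data.Fin._≟_ {n}) using (_∈?_)

  exitEdge : ∀ {a b} (L : List (Fin n)) → Walk G a b → a ∈ₗ L → ¬ b ∈ₗ L →
             Σ (Fin n) λ u → Σ (Fin n) λ w → u ∈ₗ L × ¬ w ∈ₗ L × Adj G u w
  exitEdge L []                     aL ¬bL = ⊥-elim (¬bL aL)
  exitEdge L (step {w = w} adj rest) aL ¬bL with w ∈? L
  ... | yes wL = exitEdge L rest wL ¬bL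
  ... | no ¬wL = _ , w , aL , ¬wL , adj

  mutual
    graftN : ∀ {u w} v cs → ValidL v cs → u ∈ₗ (v ∷ labsL cs) → Adj G u w →
             Σ (List (Tree n)) λ cs′ → ValidL v cs′ × (w ∷ v ∷ labsL cs ↭ v ∷ labsL cs′)
    graftN {w = w} v cs val (here refl) uw = node w [] ∷ cs , (uw , tt , val) , swap w v refl
    graftN {w = w} v cs val (there p)   uw with graftL v cs val p uw
    ... | cs′ , val′ , perm = cs′ , val′ , trans (swap w v refl) (prep v perm)

    graftL : ∀ {u w} v cs → ValidL v cs → u ∈ₗ labsL cs → Adj G u w →
             Σ (List (Tree n)) λ cs′ → ValidL v cs′ × (w ∷ labsL cs ↭ labsL cs′)
    graftL {w = w} v (node w′ ds ∷ cs) (vw′ , w′ds , vcs) p uw with ∈-++⁻ (w′ ∷ labsL ds) p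
    ... | inj₁ q with graftN w′ ds w′ds q uw
    ...   | ds′ , w′ds′ , perm = node w′ ds′ ∷ cs , (vw′ , w′ds′ , vcs) , ++⁺ʳ (labsL cs) perm
    graftL {w = w} v (node w′ ds ∷ cs) (vw′ , w′ds , vcs) p uw | inj₂ q with graftL v cs vcs q uw
    ...   | cs′ , vcs′ , perm = node w′ ds ∷ cs′ , (vw′ , w′ds , vcs′) ,
            trans (↭-sym (shift w (w′ ∷ labsL ds) (labsL cs))) (++⁺ˡ (w′ ∷ labsL ds) perm)

  record SubTree (r : Fin n) : Set where
    constructor subTree
    field
      children : List (Tree n)
      valid    : ValidL r children
      distinct : Unique (r ∷ labsL children)

  open SubTree

  treeOf : ∀ {r} → SubTree r → Tree n
  treeOf {r} T = node r (children T)

  labsT : ∀ {r} → SubTree r → List (Fin n)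
  labsT T = labs (treeOf T)

  size-treeOf : ∀ {r} (T : SubTree r) → size (treeOf T) ≤ n
  size-treeOf T = ≤-trans (≤-reflexive (size≡length (treeOf T))) (unique-length≤ (distinct T))

  module _ (connected : Connected G) {r : Fin n} where

    -- A subtree missing some vertex grows by one: follow a walk from the
    -- root to that vertex until it leaves the subtree, and graft there.
    grow : (T : SubTree r) → ¬ (∀ v → v ∈ₗ labsT T) →
           Σ (SubTree r) λ T′ → length (labsT T′) ≡ suc (length (labsT T))
    grow T incomplete
      with ¬∀⟶∃¬ n (_∈ₗ labsT T) (_∈? labsT T) incomplete
    ... | v , v∉T with exitEdge (labsT T) (connected r v) (here refl) v∉T
    ...   | u , w , u∈T , w∉T , uw with graftN r (children T) (valid T) u∈T uw
    ...     | cs′ , val′ , perm =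
      subTree cs′ val′ (unique-resp-↭ perm (All.¬Any⇒All¬ (labsT T) w∉T ∷ distinct T)) ,
      ≡.sym (↭-length perm)

    -- Growing repeatedly gives a spanning subtree, provided f more steps
    -- would reach n labels: distinct labels number at most n, so when f is
    -- exhausted the subtree cannot grow any more.
    spanWithin : ∀ f (T : SubTree r) → n ≤ f + length (labsT T) →
                 Σ (SubTree r) λ T′ → ∀ v → v ∈ₗ labsT T′
    spanWithin f T bound with all? (_∈? labsT T)
    ... | yes complete = T , complete
    ... | no incomplete with grow T incomplete | f
    ...   | T′ , grown | zero   =
      contradiction (unique-length≤ (distinct T′)) (<⇒≱ (≤-trans (s≤s bound) (≤-reflexive (≡.sym grown))))
    ...   | T′ , grown | suc f′ =
      spanWithin f′ T′ (≤-trans bound (≤-reflexive (≡.trans (≡.sym (+-suc f′ _)) (cong (f′ +_) (≡.sym grown)))))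

    spanningTree : Σ (SubTree r) λ T → ∀ v → v ∈ₗ labsT T
    spanningTree = spanWithin n (subTree [] tt ([] ∷ [])) (m≤m+n n 1)

-- Counting: ℓ disjoint blocks of m+1 vertices, m = ⌊N/(k+1)⌋, fit into N
-- vertices only if ℓ ≤ k, because N < (k+1)(m+1).
fewBlocks : ∀ N k ℓ → ℓ * suc (N / suc k) ≤ N → ℓ ≤ k
fewBlocks N k ℓ ℓ·m+1≤N = s≤s⁻¹ (*-cancelʳ-< (suc m) ℓ (suc k) (begin-strict
  ℓ * suc m            ≤⟨ ℓ·m+1≤N ⟩
  N                    ≡⟨ m≡m%n+[m/n]*n N (suc k) ⟩
  N % suc k + m * suc k <⟨ +-monoˡ-< (m * suc k) (m%n<n N (suc k)) ⟩
  suc k + m * suc k    ≡⟨ *-comm (suc m) (suc k) ⟩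
  suc k * suc m        ∎))
  where
  m : ℕ
  m = N / suc k
  open ≤-Reasoning

mainTheorem20 : (n : ℕ) (G : Graph n) → Connected G → (k : ℕ) → 1 ≤ k →
    ∃ λ (F : List (Subset n)) →
      length F ≤ k
      × All (λ S → InducedConnected G S × ∣ S ∣ ≤ 2 * (n / suc k) + 1) F
      × (∀ (v : Fin n) → Any (λ S → v ∈ S) F)
mainTheorem20 zero    G connected k k≥1 = [] , z≤n , [] , λ ()
mainTheorem20 (suc n) G connected k k≥1 =
  map (toSubset ∘ labs) pieces , fewSets , All.map⁺ (All.map pieceOK piecesOK) , coversAll
  where
  open Trees G
  m : ℕ
  m = suc n / suc k

  T : SubTree fzero
  T = proj₁ (spanningTree connected)
  open Cover (cover m (treeOf T) (SubTree.valid T))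

  fewSets : length (map (toSubset ∘ labs) pieces) ≤ k
  fewSets rewrite length-map (toSubset ∘ labs) pieces with few
  ... | inj₁ ≤1    = ≤-trans ≤1 k≥1
  ... | inj₂ ≤size = fewBlocks (suc n) k (length pieces) (≤-trans ≤size (size-treeOf T))

  pieceOK : ∀ {P} → ValidT P × size P ≤ 2 * m + 1 →
            InducedConnected G (toSubset (labs P)) × ∣ toSubset (labs P) ∣ ≤ 2 * m + 1
  pieceOK {P} (validP , small) = tree-connected P validP , ≤-trans (∣labs∣≤size P) small

  coversAll : ∀ v → Any (λ S → v ∈ S) (map (toSubset ∘ labs) pieces)
  coversAll v = Any.map⁺ (Any.map ∈-toSubset⁺ (covers (proj₂ (spanningTree connected) v)))
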